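{- Let $G=(V,E)$ be an undirected unweighted graph with $n$ vertices, let $k\ge 2$ and $R$ be integers with $R_k(G)\le R$, and let $c_1,\dots,c_k$ be vertices with $\max_{v\in V}d(v,\{c_1,\dots,c_k\})\le R$. Let $S\subseteq V$ be a uniformly random subset of size $O(\sqrt{n}\log n)$ (with a sufficiently large constant). Let $1\leq i < k$, let $r, \alpha$ be nonnegative integers with $r +\alpha \leq R$, and let $C_i = \{s_1, \ldots, s_i\}\subseteq V$ satisfy $d(s_j, c_j) \leq r$ for every $1\le j\le i$. Define $U = B(C_i, R + r)^c$ and $Y = B(C_i, 2R -\alpha)^c$. Let $w_{i+1}$ be a vertex of $U$ furthest from $S$ (i.e. maximizing $d(\cdot,S)$ over $U$), and let $W_{i+1}$ be the set of the $\sqrt{n}$ vertices closest to $w_{i+1}$. Then, with high probability, one of the following holds: (1) there exist $s_{i+1}\in W_{i+1}$ and $j > i$ such that $d(s_{i+1}, c_j) \le r + 2\alpha$; (2) there exist $k-i$ vertices in $S$ that cover $Y$ with radius $2R - \alpha$, i.e. every $y\in Y$ is at distance at most $2R-\alpha$ from one of them.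
   Context: $d$ is the shortest-path distance; $d(v,X)=\min_{x\in X}d(v,x)$. $R_k(G)=\min_{C\subseteq V,|C|=k}\max_{v\in V} d(v,C)$. For $X\subseteq V$ and $\rho\ge 0$, $B(X,\rho)=\{u\in V: d(u,X)\le \rho\}$ and $B(X,\rho)^c=\{u\in V: d(u,X)>\rho\}$. The "closest $\sqrt n$ vertices" to $w$ are the $\sqrt n$ vertices of smallest distance to $w$ (including $w$, ties broken arbitrarily). "With high probability" means with probability at least $1-1/n^{c}$ for a constant $c>0$, over the random choice of $S$. -}

module Defs where

open import Data.Nat using (ℕ; zero; suc; _+_; _*_; _∸_; _^_; _≤_; _<_; _⊓_; _≤ᵇ_)
open import Data.Nat.Logarithm using (⌊log₂_⌋)
open import Data.Nat.Combinatorics using (_C_)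
open import Data.Bool using (Bool; true; false; if_then_else_)
open import Data.Fin using (Fin; toℕ)
open import Data.Fin.Subset using (Subset; _∈_; _∉_; ∣_∣)
open import Data.List using (List; length)
open import Data.List.Relation.Unary.Unique.Propositional using (Unique)
import Data.List.Membership.Propositional as LM
open import Data.Product using (Σ; ∃; ∃-syntax; _×_)
open import Data.Sum using (_⊎_)
open import Relation.Nullary using (¬_)
open import Relation.Binary.PropositionalEquality using (_≡_)

isqrt : ℕ → ℕ
isqrt zero = zero
isqrt (suc n) with isqrt n
... | m = if (suc m * suc m) ≤ᵇ suc n then suc m else m

record Graph (n : ℕ) : Set where
  field
    adj   : Fin n → Fin n → Bool
    sym   : ∀ u v → adj u v ≡ adj v u
    irrefl : ∀ u → adj u u ≡ false

module _ {n : ℕ} (G : Graph n) where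
  open Graph G

  -- Dist≤ t u v  :  d(u,v) ≤ t  (a walk of length ≤ t from u to v exists).
  data Dist≤ : ℕ → Fin n → Fin n → Set where
    here : ∀ {t u} → Dist≤ t u u
    step : ∀ {t u w v} → adj u w ≡ true → Dist≤ t w v → Dist≤ (suc t) u v

  DistSet≤ : ℕ → Fin n → Subset n → Set
  DistSet≤ t v X = ∃[ x ] (x ∈ X × Dist≤ t v x)

  RkAtMost : ℕ → ℕ → Set
  RkAtMost k R = ∃[ C ] (∣ C ∣ ≡ k × (∀ v → DistSet≤ R v C))

  OutsideBall : ∀ {i} → (Fin i → Fin n) → ℕ → Fin n → Set
  OutsideBall s ρ v = ¬ (∃[ j ] Dist≤ ρ v (s j))

  -- w maximizes d(·,S) over the set P (distances may be infinite)
  FurthestIn : (Fin n → Set) → Subset n → Fin n → Set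
  FurthestIn P S w = P w × (∀ u → P u → ∀ t → DistSet≤ t w S → DistSet≤ t u S)

  ClosestSet : ℕ → Fin n → Subset n → Set
  ClosestSet m w W = ∣ W ∣ ≡ m ×
    (∀ x y → x ∈ W → y ∉ W → ∀ t → Dist≤ t w y → Dist≤ t w x)

-- "the number of S of size s satisfying Bad is at most (n choose s) / n^(p/q)",
-- i.e.  #Bad^q * n^p ≤ (n choose s)^q, expressed with an explicit list
-- of distinct subsets containing all bad ones.
BadFractionAtMost : (n s p q : ℕ) → (Subset n → Set) → Set
BadFractionAtMost n s p q Bad =
  Σ (List (Subset n)) λ L → Unique L ×
    (∀ S → ∣ S ∣ ≡ s → Bad S → S LM.∈ L) ×
    (length L ^ q * n ^ p ≤ (n C s) ^ q)

sampleSize : ℕ → ℕ → ℕ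
sampleSize a n = n ⊓ (a * isqrt n * suc ⌊log₂ n ⌋)

{-# OPTIONS --safe #-}
-- If S meets W_{i+1}, then (1) or (2) holds for sure. Let c_j (j > i) be a centre within R of
-- w_{i+1}; if r + 2α > R, w_{i+1} itself witnesses (1), so put ρ = R − r − 2α. If the ball of
-- radius ρ around w_{i+1} lies inside W_{i+1}, the vertex at distance ρ from w_{i+1} on a shortest
-- path to c_j witnesses (1). Otherwise W_{i+1}, and with it S, comes within ρ of w_{i+1}; as w_{i+1}
-- is furthest from S, every vertex of U is within ρ of S, and picking, for each j > i, a sample
-- point near a vertex of U close to c_j gives (2).
-- So a bad S avoids the √n closest vertices of some vertex, and a union bound over that vertex
-- leaves at most n·C(n − √n, s) ≤ C(n, s)/n bad samples of size s, because
-- (1 − √n/n)^s ≤ 1/n² once s ≥ 8 √n (1 + log₂ n).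
module Submission where

open import Defs
open import Data.Nat
  using (ℕ; zero; suc; _+_; _*_; _∸_; _^_; _≤_; _<_; _≤ᵇ_; z≤n; s≤s; _≤?_; NonZero; >-nonZero)
open import Data.Nat.Properties
open import Data.Nat.Combinatorics using (_C_; nC1≡n; nCk+nC[k+1]≡[n+1]C[k+1]; k>n⇒nCk≡0)
open import Data.Nat.Logarithm using (⌊log₂_⌋; ⌊log₂⌋-mono-≤; ⌊log₂[2^n]⌋≡n)
open import Data.Nat.Tactic.RingSolver using (solve-∀)
open import Data.Bool using (true; false; T)
open import Data.Bool.Properties using () renaming (_≟_ to _≟ᵇ_)
open import Data.Unit using (tt)
open import Data.Fin using (Fin; zero; suc; toℕ; inject≤; fromℕ<)
open import Data.Fin.Properties using (any?; toℕ<n; toℕ-inject≤; toℕ-fromℕ<; toℕ-injective)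
  renaming (_≟_ to _≟ᶠ_)
open import Data.Fin.Subset using (Subset; _∈_; _∉_; ∣_∣; inside; outside)
open import Data.Fin.Subset.Properties using (_∈?_; ∣p∣≤n)
open import Data.Vec using ([]; _∷_; here; there)
open import Data.Vec.Properties using (≡-dec)
open import Data.List using (List; []; _∷_; [_]; _++_; map; concatMap; length; allFin; deduplicate)
open import Data.List.Properties using (length-map; length-++; length-tabulate; length-deduplicate)
open import Data.List.Membership.Propositional using (lose) renaming (_∈_ to _∈ₗ_)
open import Data.List.Membership.Propositional.Properties
  using (∈-map⁺; ∈-++⁺ˡ; ∈-++⁺ʳ; ∈-allFin; ∈-concatMap⁺; ∈-deduplicate⁺)
open import Data.List.Relation.Unary.Any using (here)
import Data.List.Relation.Unary.Unique.DecPropositional.Properties as Unique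
open import Data.Product using (Σ; Σ-syntax; ∃; ∃-syntax; _×_; _,_; proj₁; proj₂)
open import Data.Sum using (_⊎_; inj₁; inj₂)
open import Data.Empty using (⊥-elim)
open import Function using (id; _∘_)
open import Relation.Nullary using (¬_; Dec; yes; no; contradiction)
open import Relation.Nullary.Decidable using (_×-dec_; ¬?; decidable-stable)
open import Relation.Binary.PropositionalEquality
  using (_≡_; refl; sym; trans; cong; cong₂; subst; module ≡-Reasoning)

module Distance {n : ℕ} (G : Graph n) where
  open Graph G using (adj)

  Dist≤-weaken : ∀ {t t′ u v} → t ≤ t′ → Dist≤ G t u v → Dist≤ G t′ u v
  Dist≤-weaken _          here       = here
  Dist≤-weaken (s≤s t≤t′) (step e d) = step e (Dist≤-weaken t≤t′ d)

  Dist≤-zero⇒≡ : ∀ {u v} → Dist≤ G 0 u v → u ≡ v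
  Dist≤-zero⇒≡ here = refl

  Dist≤-trans : ∀ {a b u v x} → Dist≤ G a u v → Dist≤ G b v x → Dist≤ G (a + b) u x
  Dist≤-trans {a} {b} here d = Dist≤-weaken (m≤n+m b a) d
  Dist≤-trans (step e d) d′  = step e (Dist≤-trans d d′)

  Dist≤-sym : ∀ {t u v} → Dist≤ G t u v → Dist≤ G t v u
  Dist≤-sym here = here
  Dist≤-sym {u = u} (step {w = w} e d) = snoc (Dist≤-sym d) (trans (Graph.sym G w u) e)
    where
    snoc : ∀ {t u v x} → Dist≤ G t u v → adj v x ≡ true → Dist≤ G (suc t) u x
    snoc here        e = step e here
    snoc (step e′ d) e = step e′ (snoc d e)

  Dist≤-split : ∀ a {b u v} → Dist≤ G (a + b) u v → ∃[ x ] (Dist≤ G a u x × Dist≤ G b x v)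
  Dist≤-split zero    d    = _ , here , d
  Dist≤-split (suc a) here = _ , here , here
  Dist≤-split (suc a) (step e d) with Dist≤-split a d
  ... | x , d₁ , d₂ = x , step e d₁ , d₂

  Dist≤? : ∀ t u v → Dec (Dist≤ G t u v)
  Dist≤? t u v with u ≟ᶠ v
  ... | yes refl = yes here
  Dist≤? zero    u v | no u≢v = no (u≢v ∘ Dist≤-zero⇒≡)
  Dist≤? (suc t) u v | no u≢v with any? (λ w → (adj u w ≟ᵇ true) ×-dec Dist≤? t w v)
  ... | yes (w , e , d) = yes (step e d)
  ... | no ∄w           = no λ { here → u≢v refl ; (step e d) → ∄w (_ , e , d) }

  outsideBall? : ∀ {i} (s : Fin i → Fin n) ρ v → Dec (OutsideBall G s ρ v)
  outsideBall? s ρ v = ¬? (any? λ j → Dist≤? ρ v (s j))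

  closestSet-∋-centre : ∀ {m w W x} → ClosestSet G m w W → x ∈ W → w ∈ W
  closestSet-∋-centre {w = w} {W} (_ , closer) x∈W with w ∈? W
  ... | yes w∈W = w∈W
  ... | no  w∉W = subst (_∈ W) (sym (Dist≤-zero⇒≡ (closer _ w x∈W w∉W 0 here))) x∈W

module _ {R : ℕ} (r α : ℕ) where
  R+r≤2R∸α : r + α ≤ R → R + r ≤ 2 * R ∸ α
  R+r≤2R∸α r+α≤R = m+n≤o⇒m≤o∸n (R + r) (begin
    R + r + α   ≡⟨ +-assoc R r α ⟩
    R + (r + α) ≤⟨ +-monoʳ-≤ R r+α≤R ⟩
    R + R       ≡⟨ cong (R +_) (sym (+-identityʳ R)) ⟩
    2 * R       ∎)
    where open ≤-Reasoning

  [R∸[r+α]]+[R+r]≤2R∸α : r + α ≤ R → (R ∸ (r + α)) + (R + r) ≤ 2 * R ∸ α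
  [R∸[r+α]]+[R+r]≤2R∸α r+α≤R = m+n≤o⇒m≤o∸n _ (≤-reflexive (begin
    (R ∸ (r + α)) + (R + r) + α   ≡⟨ regroup (R ∸ (r + α)) R r α ⟩
    R ∸ (r + α) + (r + α) + R     ≡⟨ cong (_+ R) (m∸n+n≡m r+α≤R) ⟩
    R + R                         ≡⟨ cong (R +_) (sym (+-identityʳ R)) ⟩
    2 * R                         ∎))
    where
    open ≡-Reasoning
    regroup : ∀ t R r α → t + (R + r) + α ≡ t + (r + α) + R
    regroup = solve-∀

  R+[r+α+[R∸[r+2α]]]≤2R∸α : r + 2 * α ≤ R → R + (r + α + (R ∸ (r + 2 * α))) ≤ 2 * R ∸ α
  R+[r+α+[R∸[r+2α]]]≤2R∸α r+2α≤R = m+n≤o⇒m≤o∸n _ (≤-reflexive (begin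
    R + (r + α + (R ∸ (r + 2 * α))) + α   ≡⟨ regroup R r α (R ∸ (r + 2 * α)) ⟩
    R + (R ∸ (r + 2 * α) + (r + 2 * α))   ≡⟨ cong (R +_) (m∸n+n≡m r+2α≤R) ⟩
    R + R                                 ≡⟨ cong (R +_) (sym (+-identityʳ R)) ⟩
    2 * R                                 ∎))
    where
    open ≡-Reasoning
    regroup : ∀ R r α t → R + (r + α + t) + α ≡ R + (t + (r + 2 * α))
    regroup = solve-∀

-- Fin k counts from 0: the centres c_{i+1}, …, c_k of the paper are the c j with i ≤ toℕ j.
module GreedyStep {n : ℕ} (G : Graph n) {k R : ℕ} (c : Fin k → Fin n)
            (c-covers : ∀ v → ∃[ j ] Dist≤ G R v (c j))
            {i : ℕ} (i<k : i < k) {r α : ℕ} (r+α≤R : r + α ≤ R) (s : Fin i → Fin n)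
            (s-near-c : ∀ j → Dist≤ G r (s j) (c (inject≤ j (<⇒≤ i<k))))
            where
  open Distance G

  U Y : Fin n → Set
  U = OutsideBall G s (R + r)
  Y = OutsideBall G s (2 * R ∸ α)

  ρ : ℕ
  ρ = R ∸ (r + 2 * α)

  Outcome₁ : Subset n → Set
  Outcome₁ W = ∃[ x ] (x ∈ W × ∃[ j ] (i ≤ toℕ j × Dist≤ G (r + 2 * α) x (c j)))

  Outcome₂ : Subset n → Set
  Outcome₂ S = Σ (Fin (k ∸ i) → Fin n) λ f →
    (∀ m → f m ∈ S) × (∀ y → Y y → ∃[ m ] Dist≤ G (2 * R ∸ α) y (f m))

  U⇒lateCentre : ∀ {v} → U v → ∃[ j ] (i ≤ toℕ j × Dist≤ G R v (c j))
  U⇒lateCentre {v} v∈U with c-covers v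
  ... | j , v~cj with i ≤? toℕ j
  ...   | yes i≤j = j , i≤j , v~cj
  ...   | no  i≰j = ⊥-elim (v∈U (j′ , Dist≤-trans v~cj (Dist≤-sym sj′~cj)))
    where
    j<i = ≰⇒> i≰j
    j′ = fromℕ< j<i
    sj′~cj : Dist≤ G r (s j′) (c j)
    sj′~cj = subst (λ z → Dist≤ G r (s j′) (c z))
                   (toℕ-injective (trans (toℕ-inject≤ j′ _) (toℕ-fromℕ< j<i))) (s-near-c j′)

  Y⊆U : ∀ {y} → Y y → U y
  Y⊆U y∈Y (l , y~sl) = y∈Y (l , Dist≤-weaken (R+r≤2R∸α r α r+α≤R) y~sl)

  lateIndex : Fin (k ∸ i) → Fin k
  lateIndex m = fromℕ< (subst (i + toℕ m <_) (m+[n∸m]≡n (<⇒≤ i<k)) (+-monoʳ-< i (toℕ<n m)))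

  lateIndex-onto : ∀ {j} → i ≤ toℕ j → ∃[ m ] lateIndex m ≡ j
  lateIndex-onto {j} i≤j = m , toℕ-injective (begin
    toℕ (lateIndex m)  ≡⟨ toℕ-fromℕ< _ ⟩
    i + toℕ m          ≡⟨ cong (i +_) (toℕ-fromℕ< j∸i<k∸i) ⟩
    i + (toℕ j ∸ i)    ≡⟨ m+[n∸m]≡n i≤j ⟩
    toℕ j              ∎)
    where
    open ≡-Reasoning
    j∸i<k∸i = ∸-monoˡ-< (toℕ<n j) i≤j
    m = fromℕ< j∸i<k∸i

  -- Each y ∈ Y meets U at distance r + α from its centre c_j on a shortest path, so the sample
  -- point chosen for c_j through some vertex of U within r + α of it is within 2R − α of y.
  U-near-S⇒Outcome₂ : ∀ {S x} → r + 2 * α ≤ R → x ∈ S →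
                      (∀ {u} → U u → DistSet≤ G ρ u S) → Outcome₂ S
  U-near-S⇒Outcome₂ {S} {x} r+2α≤R x∈S U-near-S =
    proj₁ ∘ sample ∘ lateIndex , proj₁ ∘ proj₂ ∘ sample ∘ lateIndex , cover
    where
    sample : (j : Fin k) → Σ[ z ∈ Fin n ] (z ∈ S ×
             (∃[ u ] (U u × Dist≤ G (r + α) (c j) u) → Dist≤ G (r + α + ρ) (c j) z))
    sample j with any? (λ u → outsideBall? s (R + r) u ×-dec Dist≤? (r + α) (c j) u)
    ... | yes (u , u∈U , cj~u) with U-near-S u∈U
    ...   | z , z∈S , u~z = z , z∈S , λ _ → Dist≤-trans cj~u u~z
    sample j | no ∄u = x , x∈S , ⊥-elim ∘ ∄u

    cover : ∀ y → Y y → ∃[ m ] Dist≤ G (2 * R ∸ α) y (proj₁ (sample (lateIndex m)))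
    cover y y∈Y with U⇒lateCentre (Y⊆U y∈Y)
    ... | j , i≤j , y~cj with lateIndex-onto i≤j
    ...   | m , refl with Dist≤-split (r + α) (subst (λ t → Dist≤ G t (c j) y)
                                                      (sym (m+[n∸m]≡n r+α≤R)) (Dist≤-sym y~cj))
    ...     | u , cj~u , u~y = m , Dist≤-weaken (R+[r+α+[R∸[r+2α]]]≤2R∸α r α r+2α≤R)
                                   (Dist≤-trans y~cj (proj₂ (proj₂ (sample j)) (u , u∈U , cj~u)))
      where
      u∈U : U u
      u∈U (l , u~sl) = y∈Y (l , Dist≤-weaken ([R∸[r+α]]+[R+r]≤2R∸α r α r+α≤R)
                                             (Dist≤-trans (Dist≤-sym u~y) u~sl))

  furthest-hit⇒Outcome : ∀ {m S w W x} → FurthestIn G U S w → ClosestSet G m w W →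
                         x ∈ S → x ∈ W → Outcome₁ W ⊎ Outcome₂ S
  furthest-hit⇒Outcome {w = w} {W} {x} (w∈U , furthest) W-closest x∈S x∈W
    with U⇒lateCentre w∈U | r + 2 * α ≤? R
  ... | j , i≤j , w~cj | no r+2α≰R =
    inj₁ (w , closestSet-∋-centre W-closest x∈W , j , i≤j , Dist≤-weaken (<⇒≤ (≰⇒> r+2α≰R)) w~cj)
  ... | j , i≤j , w~cj | yes r+2α≤R with any? (λ y → Dist≤? ρ w y ×-dec ¬? (y ∈? W))
  ...   | yes (y , w~y , y∉W) =
    inj₂ (U-near-S⇒Outcome₂ r+2α≤R x∈S λ u∈U →
            furthest _ u∈U ρ (x , x∈S , proj₂ W-closest x y x∈W y∉W ρ w~y))
  ...   | no ball⊆W with Dist≤-split ρ (subst (λ t → Dist≤ G t w (c j))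
                                              (sym (m∸n+n≡m r+2α≤R)) w~cj)
  ...     | z , w~z , z~cj =
    inj₁ (z , decidable-stable (z ∈? W) (λ z∉W → ball⊆W (z , w~z , z∉W)) , j , i≤j , z~cj)

  hit⇒Outcome : ∀ {m S w W x} → (∃ U → FurthestIn G U S w) → ClosestSet G m w W →
                x ∈ S → x ∈ W → Outcome₁ W ⊎ Outcome₂ S
  hit⇒Outcome {x = x} furthest W-closest x∈S x∈W with any? (outsideBall? s (R + r))
  ... | yes U≢∅ = furthest-hit⇒Outcome (furthest U≢∅) W-closest x∈S x∈W
  ... | no  U≡∅ = inj₂ ((λ _ → x) , (λ _ → x∈S) , λ y y∈Y → ⊥-elim (U≡∅ (y , Y⊆U y∈Y)))

subsetsAvoiding : (n : ℕ) → Subset n → ℕ → List (Subset n)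
subsetsAvoiding zero    []            zero    = [ [] ]
subsetsAvoiding zero    []            (suc s) = []
subsetsAvoiding (suc n) (inside ∷ W)  s       = map (outside ∷_) (subsetsAvoiding n W s)
subsetsAvoiding (suc n) (outside ∷ W) zero    = map (outside ∷_) (subsetsAvoiding n W zero)
subsetsAvoiding (suc n) (outside ∷ W) (suc s) =
  map (outside ∷_) (subsetsAvoiding n W (suc s)) ++ map (inside ∷_) (subsetsAvoiding n W s)

length-subsetsAvoiding : ∀ n W s → length (subsetsAvoiding n W s) ≡ (n ∸ ∣ W ∣) C s
length-subsetsAvoiding zero    []            zero    = refl
length-subsetsAvoiding zero    []            (suc s) = refl
length-subsetsAvoiding (suc n) (inside ∷ W)  s       =
  trans (length-map _ (subsetsAvoiding n W s)) (length-subsetsAvoiding n W s)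
length-subsetsAvoiding (suc n) (outside ∷ W) zero    =
  trans (length-map _ (subsetsAvoiding n W zero)) (length-subsetsAvoiding n W zero)
length-subsetsAvoiding (suc n) (outside ∷ W) (suc s) = begin
    length (map (outside ∷_) A ++ map (inside ∷_) B)
  ≡⟨ length-++ (map (outside ∷_) A) ⟩
    length (map (outside ∷_) A) + length (map (inside ∷_) B)
  ≡⟨ cong₂ _+_ (trans (length-map _ A) (length-subsetsAvoiding n W (suc s)))
               (trans (length-map _ B) (length-subsetsAvoiding n W s)) ⟩
    m C suc s + m C s
  ≡⟨ +-comm (m C suc s) (m C s) ⟩
    m C s + m C suc s
  ≡⟨ nCk+nC[k+1]≡[n+1]C[k+1] m s ⟩
    suc m C suc s
  ≡⟨ cong (_C suc s) (sym (+-∸-assoc 1 (∣p∣≤n W))) ⟩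
    (suc n ∸ ∣ W ∣) C suc s
  ∎
  where
  open ≡-Reasoning
  m = n ∸ ∣ W ∣
  A = subsetsAvoiding n W (suc s)
  B = subsetsAvoiding n W s

∈-subsetsAvoiding : ∀ {n} (W S : Subset n) → (∀ x → x ∈ S → x ∉ W) → S ∈ₗ subsetsAvoiding n W ∣ S ∣
∈-subsetsAvoiding []            []            _        = here refl
∈-subsetsAvoiding (inside ∷ W)  (inside ∷ S)  disjoint = ⊥-elim (disjoint zero here here)
∈-subsetsAvoiding (inside ∷ W)  (outside ∷ S) disjoint =
  ∈-map⁺ (outside ∷_) (∈-subsetsAvoiding W S (λ x x∈S → disjoint (suc x) (there x∈S) ∘ there))
∈-subsetsAvoiding (outside ∷ W) (inside ∷ S)  disjoint =
  ∈-++⁺ʳ (map (outside ∷_) _)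
         (∈-map⁺ (inside ∷_)
                 (∈-subsetsAvoiding W S (λ x x∈S → disjoint (suc x) (there x∈S) ∘ there)))
∈-subsetsAvoiding (outside ∷ W) (outside ∷ S) disjoint
  with ∣ S ∣ | ∈-subsetsAvoiding W S (λ x x∈S → disjoint (suc x) (there x∈S) ∘ there)
... | zero  | S∈ = ∈-map⁺ (outside ∷_) S∈
... | suc _ | S∈ = ∈-++⁺ˡ (∈-map⁺ (outside ∷_) S∈)

length-concatMap-const : ∀ {A B : Set} {ℓ} (f : A → List B) → (∀ x → length (f x) ≡ ℓ) →
                         ∀ xs → length (concatMap f xs) ≡ length xs * ℓ
length-concatMap-const f len []       = refl
length-concatMap-const f len (x ∷ xs) =
  trans (length-++ (f x)) (cong₂ _+_ (len x) (length-concatMap-const f len xs))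

subsetsAvoidingSome : ∀ {n} → (Fin n → Subset n) → ℕ → List (Subset n)
subsetsAvoidingSome {n} Ws s = concatMap (λ v → subsetsAvoiding n (Ws v) s) (allFin n)

length-subsetsAvoidingSome : ∀ {n m} (Ws : Fin n → Subset n) s → (∀ v → ∣ Ws v ∣ ≡ m) →
                             length (subsetsAvoidingSome Ws s) ≡ n * ((n ∸ m) C s)
length-subsetsAvoidingSome {n} {m} Ws s ∣Ws∣≡m =
  trans (length-concatMap-const _ len (allFin n))
        (cong (_* ((n ∸ m) C s)) (length-tabulate {n = n} id))
  where
  len : ∀ v → length (subsetsAvoiding n (Ws v) s) ≡ (n ∸ m) C s
  len v = trans (length-subsetsAvoiding n (Ws v) s) (cong (λ z → (n ∸ z) C s) (∣Ws∣≡m v))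

∈-subsetsAvoidingSome : ∀ {n} (Ws : Fin n → Subset n) v S → (∀ x → x ∈ S → x ∉ Ws v) →
                        S ∈ₗ subsetsAvoidingSome Ws ∣ S ∣
∈-subsetsAvoidingSome {n} Ws v S disjoint =
  ∈-concatMap⁺ (λ v → subsetsAvoiding n (Ws v) ∣ S ∣)
               (lose (∈-allFin v) (∈-subsetsAvoiding (Ws v) S disjoint))

BadFractionAtMost-1/n : ∀ {n s} {Bad : Subset n → Set} (K : List (Subset n)) →
                        (∀ S → ∣ S ∣ ≡ s → Bad S → S ∈ₗ K) → length K * n ≤ n C s →
                        BadFractionAtMost n s 1 1 Bad
BadFractionAtMost-1/n {n} {s} K K⊇Bad ∣K∣*n≤nCs =
  L , Unique.deduplicate-! _≟ˢ_ K ,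
  (λ S ∣S∣≡s bad → ∈-deduplicate⁺ _≟ˢ_ (K⊇Bad S ∣S∣≡s bad)) , bound
  where
  _≟ˢ_ = ≡-dec _≟ᵇ_
  L = deduplicate _≟ˢ_ K
  open ≤-Reasoning
  bound : length L ^ 1 * n ^ 1 ≤ (n C s) ^ 1
  bound = begin
    length L ^ 1 * n ^ 1  ≡⟨ cong₂ _*_ (^-identityʳ (length L)) (^-identityʳ n) ⟩
    length L * n          ≤⟨ *-monoˡ-≤ n (length-deduplicate _≟ˢ_ K) ⟩
    length K * n          ≤⟨ ∣K∣*n≤nCs ⟩
    n C s                 ≡⟨ ^-identityʳ (n C s) ⟨
    (n C s) ^ 1           ∎

[1+n]C[1+k]*[1+k]≡nCk*[1+n] : ∀ n k → (suc n C suc k) * suc k ≡ (n C k) * suc n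
[1+n]C[1+k]*[1+k]≡nCk*[1+n] n       zero    =
  trans (*-identityʳ (suc n C 1)) (trans (nC1≡n (suc n)) (sym (*-identityˡ (suc n))))
[1+n]C[1+k]*[1+k]≡nCk*[1+n] zero    (suc k) = refl
[1+n]C[1+k]*[1+k]≡nCk*[1+n] (suc n) (suc k) = begin
    (suc (suc n) C suc (suc k)) * suc (suc k)
  ≡⟨ cong (_* suc (suc k)) (pascal (suc n) (suc k)) ⟨
    (A + B) * suc (suc k)
  ≡⟨ regroup₁ A B k ⟩
    A * suc k + A + B * suc (suc k)
  ≡⟨ cong₂ (λ p q → p + A + q) ([1+n]C[1+k]*[1+k]≡nCk*[1+n] n k)
                               ([1+n]C[1+k]*[1+k]≡nCk*[1+n] n (suc k)) ⟩
    (n C k) * suc n + A + (n C suc k) * suc n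
  ≡⟨ cong (λ a → (n C k) * suc n + a + (n C suc k) * suc n) (pascal n k) ⟨
    (n C k) * suc n + (n C k + n C suc k) + (n C suc k) * suc n
  ≡⟨ regroup₂ (n C k) (n C suc k) n ⟩
    (n C k + n C suc k) * suc (suc n)
  ≡⟨ cong (_* suc (suc n)) (pascal n k) ⟩
    (suc n C suc k) * suc (suc n)
  ∎
  where
  open ≡-Reasoning
  pascal = nCk+nC[k+1]≡[n+1]C[k+1]
  A = suc n C suc k
  B = suc n C suc (suc k)
  regroup₁ : ∀ a b k → (a + b) * suc (suc k) ≡ a * suc k + a + b * suc (suc k)
  regroup₁ = solve-∀
  regroup₂ : ∀ a b n → a * suc n + (a + b) + b * suc n ≡ (a + b) * suc (suc n)
  regroup₂ = solve-∀

-- C(N, s) / C(n, s) is a product of s factors (N − t)/(n − t), each at most b/a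
-- because a N ≤ b n and b ≤ a.
NCs*a^s≤nCs*b^s : ∀ s {N n a b} → b ≤ a → a * N ≤ b * n → (N C s) * a ^ s ≤ (n C s) * b ^ s
NCs*a^s≤nCs*b^s zero    _ _ = ≤-refl
NCs*a^s≤nCs*b^s (suc s) {zero}              _ _ = z≤n
NCs*a^s≤nCs*b^s (suc s) {suc N} {zero} {zero}  _ _ =
  ≤-trans (≤-reflexive (*-zeroʳ (suc N C suc s))) z≤n
NCs*a^s≤nCs*b^s (suc s) {suc N} {zero} {suc a} {b} _ aN≤bn =
  contradiction (≤-trans aN≤bn (≤-reflexive (*-zeroʳ b))) λ ()
NCs*a^s≤nCs*b^s (suc s) {suc N} {suc n} {a} {b} b≤a aN≤bn = *-cancelʳ-≤ _ _ (suc s) (begin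
    (suc N C suc s) * (a * a ^ s) * suc s
  ≡⟨ regroup₁ (suc N C suc s) a (a ^ s) s ⟩
    (suc N C suc s) * suc s * (a * a ^ s)
  ≡⟨ cong (_* (a * a ^ s)) ([1+n]C[1+k]*[1+k]≡nCk*[1+n] N s) ⟩
    (N C s) * suc N * (a * a ^ s)
  ≡⟨ regroup₂ (N C s) N a (a ^ s) ⟩
    (N C s) * a ^ s * (a * suc N)
  ≤⟨ *-mono-≤ (NCs*a^s≤nCs*b^s s b≤a aN≤bn′) aN≤bn ⟩
    (n C s) * b ^ s * (b * suc n)
  ≡⟨ regroup₂ (n C s) n b (b ^ s) ⟨
    (n C s) * suc n * (b * b ^ s)
  ≡⟨ cong (_* (b * b ^ s)) ([1+n]C[1+k]*[1+k]≡nCk*[1+n] n s) ⟨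
    (suc n C suc s) * suc s * (b * b ^ s)
  ≡⟨ regroup₁ (suc n C suc s) b (b ^ s) s ⟨
    (suc n C suc s) * (b * b ^ s) * suc s
  ∎)
  where
  open ≤-Reasoning
  aN≤bn′ : a * N ≤ b * n
  aN≤bn′ = +-cancelʳ-≤ b _ _ (begin
    a * N + b      ≤⟨ +-monoʳ-≤ (a * N) b≤a ⟩
    a * N + a      ≡⟨ +-comm (a * N) a ⟩
    a + a * N      ≡⟨ *-suc a N ⟨
    a * suc N      ≤⟨ aN≤bn ⟩
    b * suc n      ≡⟨ *-suc b n ⟩
    b + b * n      ≡⟨ +-comm b (b * n) ⟩
    b * n + b      ∎)
  regroup₁ : ∀ C a p s → C * (a * p) * suc s ≡ C * suc s * (a * p)
  regroup₁ = solve-∀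
  regroup₂ : ∀ C N a p → C * suc N * (a * p) ≡ C * p * (a * suc N)
  regroup₂ = solve-∀

x^b*[x+b*y]≤x*[x+y]^b : ∀ x y b → x ^ b * (x + b * y) ≤ x * (x + y) ^ b
x^b*[x+b*y]≤x*[x+y]^b x y zero    = ≤-reflexive (base x y)
  where
  base : ∀ x y → 1 * (x + 0 * y) ≡ x * 1
  base = solve-∀
x^b*[x+b*y]≤x*[x+y]^b x y (suc b) = begin
    x * x ^ b * (x + suc b * y)
  ≡⟨ regroup₁ x (x ^ b) y b ⟩
    x ^ b * (x * (x + suc b * y))
  ≤⟨ *-monoʳ-≤ (x ^ b) (≤-trans (m≤m+n _ (b * y * y)) (≤-reflexive (expand x y b))) ⟩
    x ^ b * ((x + b * y) * (x + y))
  ≡⟨ *-assoc (x ^ b) _ _ ⟨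
    x ^ b * (x + b * y) * (x + y)
  ≤⟨ *-monoˡ-≤ (x + y) (x^b*[x+b*y]≤x*[x+y]^b x y b) ⟩
    x * (x + y) ^ b * (x + y)
  ≡⟨ regroup₂ x ((x + y) ^ b) (x + y) ⟩
    x * ((x + y) * (x + y) ^ b)
  ∎
  where
  open ≤-Reasoning
  regroup₁ : ∀ x p y b → x * p * (x + suc b * y) ≡ p * (x * (x + suc b * y))
  regroup₁ = solve-∀
  expand : ∀ x y b → x * (x + suc b * y) + b * y * y ≡ (x + b * y) * (x + y)
  expand = solve-∀
  regroup₂ : ∀ x p q → x * p * q ≡ x * (q * p)
  regroup₂ = solve-∀

2*x^b≤[x+y]^b : ∀ {x y b} → 1 ≤ b → x ≤ b * y → 2 * x ^ b ≤ (x + y) ^ b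
2*x^b≤[x+y]^b {zero}    {b = suc _} _ _ = z≤n
2*x^b≤[x+y]^b {x@(suc _)} {y} {b} _ x≤by = *-cancelʳ-≤ _ _ x (begin
  2 * x ^ b * x        ≡⟨ regroup x (x ^ b) ⟩
  x ^ b * (x + x)      ≤⟨ *-monoʳ-≤ (x ^ b) (+-monoʳ-≤ x x≤by) ⟩
  x ^ b * (x + b * y)  ≤⟨ x^b*[x+b*y]≤x*[x+y]^b x y b ⟩
  x * (x + y) ^ b      ≡⟨ *-comm x _ ⟩
  (x + y) ^ b * x      ∎)
  where
  open ≤-Reasoning
  regroup : ∀ x p → 2 * p * x ≡ p * (x + x)
  regroup = solve-∀

2^j*x^[b*j]≤[x+y]^[b*j] : ∀ {x y b} → 1 ≤ b → x ≤ b * y →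
                          ∀ j → 2 ^ j * x ^ (b * j) ≤ (x + y) ^ (b * j)
2^j*x^[b*j]≤[x+y]^[b*j] {b = b} _ _ zero rewrite *-zeroʳ b = ≤-refl
2^j*x^[b*j]≤[x+y]^[b*j] {x} {y} {b} 1≤b x≤by (suc j) = begin
    2 * 2 ^ j * x ^ (b * suc j)
  ≡⟨ cong (2 * 2 ^ j *_) (trans (cong (x ^_) (*-suc b j)) (^-distribˡ-+-* x b (b * j))) ⟩
    2 * 2 ^ j * (x ^ b * x ^ (b * j))
  ≡⟨ regroup 2 (2 ^ j) (x ^ b) (x ^ (b * j)) ⟩
    (2 * x ^ b) * (2 ^ j * x ^ (b * j))
  ≤⟨ *-mono-≤ (2*x^b≤[x+y]^b 1≤b x≤by) (2^j*x^[b*j]≤[x+y]^[b*j] 1≤b x≤by j) ⟩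
    (x + y) ^ b * (x + y) ^ (b * j)
  ≡⟨ trans (cong ((x + y) ^_) (*-suc b j)) (^-distribˡ-+-* (x + y) b (b * j)) ⟨
    (x + y) ^ (b * suc j)
  ∎
  where
  open ≤-Reasoning
  regroup : ∀ t p q r → t * p * (q * r) ≡ (t * q) * (p * r)
  regroup = solve-∀

-- Every 4y factors x/(x + y) halve the product (Bernoulli, as x ≤ 4y·y), and 2 (L + 1) halvings
-- outweigh (x + y)² < 4^(L + 1).
[x+y]²*x^s≤[x+y]^s : ∀ {x y L s} → 1 ≤ y → x ≤ 4 * y * y → x + y < 2 ^ suc L → 8 * y * suc L ≤ s →
                     (x + y) * (x + y) * x ^ s ≤ (x + y) ^ s
[x+y]²*x^s≤[x+y]^s {x} {y} {L} {s} 1≤y x≤4yy x+y<2^[1+L] 8y[1+L]≤s =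
  subst (λ t → N * N * x ^ t ≤ N ^ t) (m+[n∸m]≡n bj≤s) (begin
    N * N * x ^ (b * j + t)
  ≡⟨ cong (N * N *_) (^-distribˡ-+-* x (b * j) t) ⟩
    N * N * (x ^ (b * j) * x ^ t)
  ≡⟨ *-assoc (N * N) _ _ ⟨
    N * N * x ^ (b * j) * x ^ t
  ≤⟨ *-mono-≤ (*-monoˡ-≤ (x ^ (b * j)) N²≤2^j) (^-monoˡ-≤ t (m≤m+n x y)) ⟩
    2 ^ j * x ^ (b * j) * N ^ t
  ≤⟨ *-monoˡ-≤ (N ^ t) (2^j*x^[b*j]≤[x+y]^[b*j] (≤-trans 1≤y (m≤n*m y 4)) x≤4yy j) ⟩
    N ^ (b * j) * N ^ t
  ≡⟨ ^-distribˡ-+-* N (b * j) t ⟨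
    N ^ (b * j + t)
  ∎)
  where
  open ≤-Reasoning
  N = x + y
  b = 4 * y
  j = 2 * suc L
  t = s ∸ b * j
  bj≤s : b * j ≤ s
  bj≤s = subst (_≤ s) (sym (regroup y (suc L))) 8y[1+L]≤s
    where
    regroup : ∀ y l → 4 * y * (2 * l) ≡ 8 * y * l
    regroup = solve-∀
  N²≤2^j : N * N ≤ 2 ^ j
  N²≤2^j = begin
    N * N                      ≤⟨ *-mono-≤ (<⇒≤ x+y<2^[1+L]) (<⇒≤ x+y<2^[1+L]) ⟩
    2 ^ suc L * 2 ^ suc L      ≡⟨ ^-distribˡ-+-* 2 (suc L) (suc L) ⟨
    2 ^ (suc L + suc L)        ≡⟨ cong (λ e → 2 ^ (suc L + e)) (+-identityʳ (suc L)) ⟨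
    2 ^ j                      ∎

isqrt-bounds : ∀ n → isqrt n * isqrt n ≤ n × n < suc (isqrt n) * suc (isqrt n)
isqrt-bounds zero = z≤n , s≤s z≤n
isqrt-bounds (suc n) with isqrt n | isqrt-bounds n
... | m | m²≤n , n<[1+m]² with suc m * suc m ≤ᵇ suc n in fits
... | true  = ≤ᵇ⇒≤ (suc m * suc m) (suc n) (subst T (sym fits) tt) ,
              ≤-<-trans n<[1+m]² (*-mono-< (n<1+n (suc m)) (n<1+n (suc m)))
... | false = ≤-trans m²≤n (n≤1+n n) , ≰⇒> (λ le → subst T fits (≤⇒≤ᵇ le))

n<2^[1+⌊log₂n⌋] : ∀ n → n < 2 ^ suc ⌊log₂ n ⌋
n<2^[1+⌊log₂n⌋] n = ≰⇒> λ 2^[1+L]≤n →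
  1+n≰n (subst (_≤ ⌊log₂ n ⌋) (⌊log₂[2^n]⌋≡n (suc ⌊log₂ n ⌋)) (⌊log₂⌋-mono-≤ 2^[1+L]≤n))

n*[[n∸m]Cs]*n≤nCs : ∀ {n m L s} → 1 ≤ m → m * m ≤ n → n < suc m * suc m → n < 2 ^ suc L →
                    8 * m * suc L ≤ s → n * ((n ∸ m) C s) * n ≤ n C s
n*[[n∸m]Cs]*n≤nCs {n} {m} {L} {s} 1≤m m²≤n n<[1+m]² n<2^[1+L] 8m[1+L]≤s =
  *-cancelʳ-≤ _ _ (n ^ s) (begin
    n * ((n ∸ m) C s) * n * n ^ s    ≡⟨ regroup₁ n ((n ∸ m) C s) (n ^ s) ⟩
    ((n ∸ m) C s) * n ^ s * (n * n)  ≤⟨ *-monoˡ-≤ (n * n) binomial-ratio ⟩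
    (n C s) * (n ∸ m) ^ s * (n * n)  ≡⟨ regroup₂ (n C s) ((n ∸ m) ^ s) n ⟩
    (n C s) * (n * n * (n ∸ m) ^ s)  ≤⟨ *-monoʳ-≤ (n C s) n²[n∸m]^s≤n^s ⟩
    (n C s) * n ^ s                  ∎)
  where
  open ≤-Reasoning
  instance
    n≢0 : NonZero n
    n≢0 = >-nonZero (≤-trans (*-mono-≤ 1≤m 1≤m) m²≤n)
    n^s≢0 : NonZero (n ^ s)
    n^s≢0 = m^n≢0 n s
  binomial-ratio : ((n ∸ m) C s) * n ^ s ≤ (n C s) * (n ∸ m) ^ s
  binomial-ratio = NCs*a^s≤nCs*b^s s (m∸n≤m n m) (≤-reflexive (*-comm n (n ∸ m)))
  [n∸m]+m≡n : (n ∸ m) + m ≡ n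
  [n∸m]+m≡n = m∸n+n≡m (≤-trans (m≤m*n m m {{>-nonZero 1≤m}}) m²≤n)
  n∸m≤4mm : n ∸ m ≤ 4 * m * m
  n∸m≤4mm = begin
    n ∸ m              ≤⟨ m∸n≤m n m ⟩
    n                  ≤⟨ <⇒≤ n<[1+m]² ⟩
    suc m * suc m      ≤⟨ *-mono-≤ 1+m≤2m 1+m≤2m ⟩
    2 * m * (2 * m)    ≡⟨ square-double m ⟩
    4 * m * m          ∎
    where
    1+m≤2m : suc m ≤ 2 * m
    1+m≤2m = subst (_≤ 2 * m) (+-comm m 1) (+-monoʳ-≤ m (≤-trans 1≤m (m≤m+n m 0)))
    square-double : ∀ m → 2 * m * (2 * m) ≡ 4 * m * m
    square-double = solve-∀
  n²[n∸m]^s≤n^s : n * n * (n ∸ m) ^ s ≤ n ^ s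
  n²[n∸m]^s≤n^s = subst (λ N → N * N * (n ∸ m) ^ s ≤ N ^ s) [n∸m]+m≡n
    ([x+y]²*x^s≤[x+y]^s 1≤m n∸m≤4mm (subst (_< 2 ^ suc L) (sym [n∸m]+m≡n) n<2^[1+L]) 8m[1+L]≤s)
  regroup₁ : ∀ n c p → n * c * n * p ≡ c * p * (n * n)
  regroup₁ = solve-∀
  regroup₂ : ∀ c q n → c * q * (n * n) ≡ c * (n * n * q)
  regroup₂ = solve-∀

n*[[n∸√n]Cs]*n≤nCs : ∀ {a} n → 8 ≤ a →
                     n * ((n ∸ isqrt n) C sampleSize a n) * n ≤ n C sampleSize a n
n*[[n∸√n]Cs]*n≤nCs zero _ = z≤n
n*[[n∸√n]Cs]*n≤nCs {a} n@(suc _) 8≤a = bySize (n ≤? a * m * suc L)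
  where
  m = isqrt n
  L = ⌊log₂ n ⌋
  m²≤n = proj₁ (isqrt-bounds n)
  n<[1+m]² = proj₂ (isqrt-bounds n)
  1≤m : 1 ≤ m
  1≤m with m | n<[1+m]²
  ... | zero  | s≤s ()
  ... | suc _ | _ = s≤s z≤n
  m≤n : m ≤ n
  m≤n = ≤-trans (m≤m*n m m {{>-nonZero 1≤m}}) m²≤n
  bySize : Dec (n ≤ a * m * suc L) → n * ((n ∸ m) C sampleSize a n) * n ≤ n C sampleSize a n
  bySize (yes n≤X) =
    subst (λ t → n * ((n ∸ m) C t) * n ≤ n C t) (sym (m≤n⇒m⊓n≡m n≤X)) nothing-avoids
    where
    nothing-avoids : n * ((n ∸ m) C n) * n ≤ n C n
    nothing-avoids rewrite k>n⇒nCk≡0 (∸-monoʳ-< 1≤m m≤n) | *-zeroʳ n = z≤n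
  bySize (no n≰X) = subst (λ t → n * ((n ∸ m) C t) * n ≤ n C t) (sym (m≥n⇒m⊓n≡n (<⇒≤ (≰⇒> n≰X))))
    (n*[[n∸m]Cs]*n≤nCs 1≤m m²≤n n<[1+m]² (n<2^[1+⌊log₂n⌋] n) (*-monoˡ-≤ (suc L) (*-monoˡ-≤ m 8≤a)))

mainTheorem14 : ∃[ a₀ ] ∀ a → a₀ ≤ a → ∃[ p ] ∃[ q ] (1 ≤ p × 1 ≤ q ×
    (∀ (n : ℕ) (G : Graph n) (k R : ℕ) → 2 ≤ k → RkAtMost G k R →
     (c : Fin k → Fin n) → (∀ v → ∃[ j ] Dist≤ G R v (c j)) →
     (i : ℕ) → 1 ≤ i → (i<k : i < k) → (r α : ℕ) → r + α ≤ R →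
     (s : Fin i → Fin n) → (∀ j → Dist≤ G r (s j) (c (inject≤ j (<⇒≤ i<k)))) →
     (wsel : Subset n → Fin n) →
     (∀ S → ∃[ u ] OutsideBall G s (R + r) u →
        FurthestIn G (OutsideBall G s (R + r)) S (wsel S)) →
     (Wsel : Fin n → Subset n) → (∀ w → ClosestSet G (isqrt n) w (Wsel w)) →
     BadFractionAtMost n (sampleSize a n) p q (λ S → ¬ (
       (∃[ x ] (x ∈ Wsel (wsel S) × ∃[ j ] (i ≤ toℕ j × Dist≤ G (r + 2 * α) x (c j))))
       ⊎
       (Σ (Fin (k ∸ i) → Fin n) λ f → ((∀ (m : Fin (k ∸ i)) → f m ∈ S) ×
         (∀ y → OutsideBall G s (2 * R ∸ α) y → ∃[ m ] Dist≤ G (2 * R ∸ α) y (f m))))))))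
mainTheorem14 = 8 , λ a 8≤a → 1 , 1 , ≤-refl , ≤-refl ,
  λ n G k R _ _ c c-covers i _ i<k r α r+α≤R s s-near-c wsel wsel-furthest Wsel Wsel-closest →
  let open GreedyStep G c c-covers i<k r+α≤R s s-near-c
      size = sampleSize a n
      bad⇒avoids : ∀ S → ∣ S ∣ ≡ size → ¬ (Outcome₁ (Wsel (wsel S)) ⊎ Outcome₂ S) →
                   S ∈ₗ subsetsAvoidingSome Wsel size
      bad⇒avoids S ∣S∣≡size bad = subst (λ t → S ∈ₗ subsetsAvoidingSome Wsel t) ∣S∣≡size
        (∈-subsetsAvoidingSome Wsel (wsel S) S λ x x∈S x∈W →
           bad (hit⇒Outcome (wsel-furthest S) (Wsel-closest (wsel S)) x∈S x∈W))
  in BadFractionAtMost-1/n (subsetsAvoidingSome Wsel size) bad⇒avoids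
       (subst (λ ℓ → ℓ * n ≤ n C size)
              (sym (length-subsetsAvoidingSome Wsel size (proj₁ ∘ Wsel-closest)))
              (n*[[n∸√n]Cs]*n≤nCs n 8≤a))
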